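{- Let $n \ge 4$ and let $G$ be the graph obtained from a cycle $C_n$ by adding an edge between two nonadjacent vertices of the cycle. Then $\gamma_g(G) \le \left\lceil \frac{n(G)}{2}\right\rceil$.
   Context: The domination game on a graph $G$ is played by Dominator and Staller, who alternately select vertices of $G$; each selected vertex must dominate (i.e., be equal or adjacent to) at least one vertex not dominated by the previously selected vertices. The game ends when no such move is possible. Dominator wants to minimize the number of moves, Staller to maximize it. $\gamma_g(G)$ is the number of moves when both play optimally and Dominator makes the first move. $n(G)$ denotes the number of vertices of $G$. -}

module Defs where

open import Data.Bool using (Bool; true; false; _∧_; _∨_; not)
open import Data.Nat using (ℕ; zero; suc; _⊓_; _⊔_) renaming (_≡ᵇ_ to _==_)
open import Data.Fin using (Fin; toℕ)
open import Data.List using (List; []; _∷_; map; filterᵇ; allFin; foldr)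
open import Data.Bool.ListAction using (any)

record Graph : Set where
  field
    n   : ℕ
    adj : Fin n → Fin n → Bool
open Graph public

VSet : ℕ → Set
VSet k = Fin k → Bool

module _ (G : Graph) where
  closedNbr : Fin (n G) → Fin (n G) → Bool
  closedNbr v u = (toℕ u == toℕ v) ∨ adj G v u

  legal : VSet (n G) → Fin (n G) → Bool
  legal D v = any (λ u → closedNbr v u ∧ not (D u)) (allFin (n G))

  play : VSet (n G) → Fin (n G) → VSet (n G)
  play D v u = D u ∨ closedNbr v u

data Player : Set where
  dominator staller : Player

other : Player → Player
other dominator = staller
other staller   = dominator

optimum : Player → ℕ → List ℕ → ℕ
optimum dominator x xs = foldr _⊓_ x xs
optimum staller   x xs = foldr _⊔_ x xs

-- value (remaining number of moves under optimal play) of the game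
-- position with dominated set D and player p to move.  The fuel
-- argument bounds the recursion depth; since every legal move
-- dominates a new vertex, any game lasts at most n(G) moves, so fuel
-- n(G) is never exhausted before the game ends.
gameValue : (G : Graph) → ℕ → Player → VSet (n G) → ℕ
gameValue G zero    p D = 0
gameValue G (suc f) p D with filterᵇ (legal G D) (allFin (n G))
... | []     = 0
... | v ∷ vs = suc (optimum p (val v) (map val vs))
  where
  val : Fin (n G) → ℕ
  val w = gameValue G f (other p) (play G D w)

γg : Graph → ℕ
γg G = gameValue G (n G) dominator (λ _ → false)

cycSucc : (k : ℕ) → Fin k → Fin k → Bool
cycSucc k i j = (suc (toℕ i) == toℕ j) ∨ ((suc (toℕ i) == k) ∧ (toℕ j == 0))

cycAdj : (k : ℕ) → Fin k → Fin k → Bool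
cycAdj k i j = cycSucc k i j ∨ cycSucc k j i

cycleWithChord : (k : ℕ) → Fin k → Fin k → Graph
cycleWithChord k a b = record
  { n   = k
  ; adj = λ i j → cycAdj k i j
                  ∨ ((toℕ i == toℕ a) ∧ (toℕ j == toℕ b))
                  ∨ ((toℕ i == toℕ b) ∧ (toℕ j == toℕ a)) }

module Submission where

open import Defs
open import Data.Bool using (Bool; true; false; _∧_; _∨_; not; T; T?)
open import Data.Bool.Properties using (T-≡; ∨-identityʳ; ∧-zeroʳ; not-injective; ¬-not) renaming (_≟_ to _≟ᵇ_)
open import Data.Nat using (ℕ; zero; suc; _+_; _*_; _∸_; _≤_; _<_; z≤n; s≤s; ⌊_/2⌋; ⌈_/2⌉; _⊓_; _⊔_; _≤ᵇ_) renaming (_≡ᵇ_ to _==_)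
open import Data.Nat.Properties
open import Data.Nat.DivMod
open import Data.Nat.Tactic.RingSolver using (solve-∀)
open import Data.Fin using (Fin; toℕ; fromℕ<)
open import Data.Fin.Properties using (toℕ-injective; toℕ-fromℕ<; toℕ<n; any?)
open import Relation.Nullary using (yes; no)
open import Data.Product using (∃-syntax; _×_; _,_; proj₁; proj₂)
open import Data.Sum using (_⊎_; inj₁; inj₂)
open import Data.Empty using (⊥; ⊥-elim)
open import Function using (_∘_; Equivalence)
open import Relation.Binary.PropositionalEquality
open import Data.List using (List; []; _∷_; map; filterᵇ; allFin; foldr)
open import Data.List.Membership.Propositional using (_∈_; lose)
open import Data.List.Relation.Unary.Any using (here; there; satisfied)
open import Data.List.Relation.Unary.Any.Properties using (any⁺; any⁻)
open import Data.List.Membership.Propositional.Properties using (∈-allFin; ∈-filter⁺; ∈-filter⁻)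

-- Let G be C_K (K = 4 + r, vertices 0, …, K − 1) plus a chord ab.  For a set
-- D of dominated vertices let u_m say that vertex m mod K is undominated and
-- put  Φ(D) = Σ_{m<K} ψ(u_m, u_{m+1})  with ψ(1,1) = 1, ψ(1,0) = 2 and
-- ψ(0,·) = 0, i.e. twice the undominated vertices minus the undominated
-- cyclic pairs.  Once a and b are dominated the chord dominates nothing new,
-- so a move at v only affects v − 1, v, v + 1 and changes only the four terms
-- of Φ in the window of five flags around v.  A finite check of windows shows
-- that every legal move lowers Φ by at least 1, and that Dominator can lower
-- it by 3 (at the end of a run of undominated vertices) or, if there is no
-- such run end, by 2 while Φ is even.  A potential argument valid for every
-- graph then bounds the rest of the game by ⌊Φ/2⌋ with Dominator and ⌈Φ/2⌉
-- with Staller to move.  Dominator opens at a, dominating a, b and the cycle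
-- neighbours of a, leaving Φ ≤ K − 2; hence γ_g(G) ≤ 1 + ⌈(K − 2)/2⌉ = ⌈K/2⌉.

T⇒≡ : ∀ {b} → T b → b ≡ true
T⇒≡ = Equivalence.to T-≡

≡⇒T : ∀ {b} → b ≡ true → T b
≡⇒T = Equivalence.from T-≡

∨-introˡ : ∀ {x} y → x ≡ true → x ∨ y ≡ true
∨-introˡ _ refl = refl

∨-introʳ : ∀ x {y} → y ≡ true → x ∨ y ≡ true
∨-introʳ true  _ = refl
∨-introʳ false e = e

∨-elim : ∀ x y → x ∨ y ≡ true → x ≡ true ⊎ y ≡ true
∨-elim true  _ _ = inj₁ refl
∨-elim false _ e = inj₂ e

∧-intro : ∀ {x y} → x ≡ true → y ≡ true → x ∧ y ≡ true
∧-intro refl refl = refl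

∧-elim : ∀ x y → x ∧ y ≡ true → x ≡ true × y ≡ true
∧-elim true true _ = refl , refl

==⇒≡ : ∀ m n → (m == n) ≡ true → m ≡ n
==⇒≡ m n e = ≡ᵇ⇒≡ m n (≡⇒T e)

==-refl : ∀ m → (m == m) ≡ true
==-refl m = T⇒≡ (≡⇒≡ᵇ m m refl)

foldr-⊓-≤ : ∀ {A : Set} (g : A → ℕ) x xs {w} → w ∈ x ∷ xs → foldr _⊓_ (g x) (map g xs) ≤ g w
foldr-⊓-≤ g x []       (here refl)         = ≤-refl
foldr-⊓-≤ g x (y ∷ ys) (here refl)         = ≤-trans (m⊓n≤n (g y) _) (foldr-⊓-≤ g x ys (here refl))
foldr-⊓-≤ g x (y ∷ ys) (there (here refl)) = m⊓n≤m (g y) _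
foldr-⊓-≤ g x (y ∷ ys) (there (there m))   = ≤-trans (m⊓n≤n (g y) _) (foldr-⊓-≤ g x ys (there m))

foldr-⊔-< : ∀ {A : Set} (g : A → ℕ) x xs {N} → (∀ w → w ∈ x ∷ xs → suc (g w) ≤ N) →
            suc (foldr _⊔_ (g x) (map g xs)) ≤ N
foldr-⊔-< g x []       h = h x (here refl)
foldr-⊔-< g x (y ∷ ys) h = ⊔-lub (h y (there (here refl))) (foldr-⊔-< g x ys λ w m → h w (skip m))
  where
  skip : ∀ {w} → w ∈ x ∷ ys → w ∈ x ∷ y ∷ ys
  skip (here p)  = here p
  skip (there m) = there (there m)

module Game (G : Graph) where

  legal⇒∈moves : ∀ D v → legal G D v ≡ true → v ∈ filterᵇ (legal G D) (allFin (n G))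
  legal⇒∈moves D v l = ∈-filter⁺ (T? ∘ legal G D) (∈-allFin v) (≡⇒T l)

  ∈moves⇒legal : ∀ D v → v ∈ filterᵇ (legal G D) (allFin (n G)) → legal G D v ≡ true
  ∈moves⇒legal D v m = T⇒≡ (proj₂ (∈-filter⁻ (T? ∘ legal G D) {xs = allFin (n G)} m))

  undominated⇒legal : ∀ D v → D v ≡ false → legal G D v ≡ true
  undominated⇒legal D v h =
    T⇒≡ (any⁺ _ (lose (∈-allFin v) (≡⇒T (∧-intro (∨-introˡ _ (==-refl (toℕ v))) (cong not h)))))

  legal⇒witness : ∀ D v → legal G D v ≡ true → ∃[ u ] closedNbr G v u ≡ true × D u ≡ false
  legal⇒witness D v l with satisfied (any⁻ _ (allFin (n G)) (≡⇒T l))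
  ... | u , h with ∧-elim (closedNbr G v u) (not (D u)) (T⇒≡ h)
  ... | reached , fresh = u , reached , not-injective fresh

  over-or-legal : ∀ f p D → gameValue G (suc f) p D ≡ 0 ⊎ ∃[ v ] legal G D v ≡ true
  over-or-legal f p D with filterᵇ (legal G D) (allFin (n G)) in eq
  ... | []    = inj₁ refl
  ... | v ∷ _ = inj₂ (v , ∈moves⇒legal D v (subst (v ∈_) (sym eq) (here refl)))

  dominator-plays : ∀ f D v → legal G D v ≡ true →
                    gameValue G (suc f) dominator D ≤ suc (gameValue G f staller (play G D v))
  dominator-plays f D v l with filterᵇ (legal G D) (allFin (n G)) in eq
  ... | [] with () ← subst (v ∈_) eq (legal⇒∈moves D v l)
  ... | w ∷ ws = s≤s (foldr-⊓-≤ (λ x → gameValue G f staller (play G D x)) w ws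
                       (subst (v ∈_) eq (legal⇒∈moves D v l)))

  staller-bounded : ∀ f D N →
                    (∀ v → legal G D v ≡ true → suc (gameValue G f dominator (play G D v)) ≤ N) →
                    gameValue G (suc f) staller D ≤ N
  staller-bounded f D N h with filterᵇ (legal G D) (allFin (n G)) in eq
  ... | []     = z≤n
  ... | w ∷ ws = foldr-⊔-< (λ x → gameValue G f dominator (play G D x)) w ws
                   (λ v m → h v (∈moves⇒legal D v (subst (v ∈_) (sym eq) m)))

  module PotentialBound
    (Inv : VSet (n G) → Set)
    (inv-play : ∀ D v → Inv D → Inv (play G D v))
    (B : Player → VSet (n G) → ℕ)
    (dominator-step : ∀ D → Inv D → ∀ v → legal G D v ≡ true →
                      ∃[ w ] legal G D w ≡ true × suc (B staller (play G D w)) ≤ B dominator D)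
    (staller-step : ∀ D → Inv D → ∀ v → legal G D v ≡ true →
                    suc (B dominator (play G D v)) ≤ B staller D)
    where

    gameValue≤B : ∀ f p D → Inv D → gameValue G f p D ≤ B p D
    gameValue≤B zero    p         D i = z≤n
    gameValue≤B (suc f) staller   D i =
      staller-bounded f D (B staller D) λ v l →
        ≤-trans (s≤s (gameValue≤B f dominator (play G D v) (inv-play D v i))) (staller-step D i v l)
    gameValue≤B (suc f) dominator D i with over-or-legal f dominator D
    ... | inj₁ over = subst (_≤ B dominator D) (sym over) z≤n
    ... | inj₂ (v₀ , l₀) with dominator-step D i v₀ l₀
    ... | w , l , drop =
      ≤-trans (dominator-plays f D w l)
              (≤-trans (s≤s (gameValue≤B f staller (play G D w) (inv-play D w i))) drop)

-- Halving: the arithmetic behind the bounds ⌊Φ/2⌋ (Dominator to move)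
-- and ⌈Φ/2⌉ (Staller to move).

halve-drop-3 : ∀ {m n} → 3 + m ≤ n → suc ⌈ m /2⌉ ≤ ⌊ n /2⌋
halve-drop-3 = ⌊n/2⌋-mono

halve-drop-2-even : ∀ q {m} → 2 + m ≤ q + q → suc ⌈ m /2⌉ ≤ ⌊ q + q /2⌋
halve-drop-2-even zero    ()
halve-drop-2-even (suc q) {m} le rewrite +-suc q q | sym (n≡⌊n+n/2⌋ q) =
  s≤s (≤-trans (⌈n/2⌉-mono (≤-pred (≤-pred le))) (≤-reflexive (sym (n≡⌈n+n/2⌉ q))))

halve-drop-1 : ∀ {m n} → 1 + m ≤ n → suc ⌊ m /2⌋ ≤ ⌈ n /2⌉
halve-drop-1 le = ⌊n/2⌋-mono (s≤s le)

halve-drop-opening : ∀ {m n} → 2 + m ≤ n → suc ⌈ m /2⌉ ≤ ⌈ n /2⌉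
halve-drop-opening le = ⌊n/2⌋-mono (s≤s le)

-- The pair weight ψ
-- counts 2 for an undominated vertex followed by a dominated one, 1 for
-- two consecutive undominated vertices; so a segment of flags weighs
-- twice its undominated vertices minus its undominated consecutive pairs.

ψ : Bool → Bool → ℕ
ψ true  true  = 1
ψ true  false = 2
ψ false _     = 0

weight : (ℕ → Bool) → ℕ → ℕ → ℕ
weight U c zero    = 0
weight U c (suc n) = ψ (U c) (U (suc c)) + weight U (suc c) n

window : Bool → Bool → Bool → Bool → Bool → ℕ
window x₀ x₁ x₂ x₃ x₄ = ψ x₀ x₁ + (ψ x₁ x₂ + (ψ x₂ x₃ + ψ x₃ x₄))

windowAt : (ℕ → Bool) → ℕ → ℕ
windowAt U c = window (U c) (U (suc c)) (U (2 + c)) (U (3 + c)) (U (4 + c))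

window-cong : ∀ {x₀ x₁ x₂ x₃ x₄ y₀ y₁ y₂ y₃ y₄} →
              x₀ ≡ y₀ → x₁ ≡ y₁ → x₂ ≡ y₂ → x₃ ≡ y₃ → x₄ ≡ y₄ →
              window x₀ x₁ x₂ x₃ x₄ ≡ window y₀ y₁ y₂ y₃ y₄
window-cong refl refl refl refl refl = refl

weight-snoc : ∀ U n c → weight U c (suc n) ≡ weight U c n + ψ (U (n + c)) (U (suc (n + c)))
weight-snoc U zero    c = +-identityʳ _
weight-snoc U (suc n) c rewrite weight-snoc U n (suc c) | +-suc n c =
  sym (+-assoc (ψ (U c) (U (suc c))) (weight U (suc c) n) _)

weight-cong : ∀ U V n c → (∀ j → j ≤ n → U (j + c) ≡ V (j + c)) → weight U c n ≡ weight V c n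
weight-cong U V zero    c h = refl
weight-cong U V (suc n) c h =
  cong₂ _+_ (cong₂ ψ (h 0 z≤n) (h 1 (s≤s z≤n)))
            (weight-cong U V n (suc c) λ j j≤n → subst (λ z → U z ≡ V z) (sym (+-suc j c)) (h (suc j) (s≤s j≤n)))

weight-rotate : ∀ U K → (∀ m → U (m + K) ≡ U m) → ∀ c → weight U 0 K ≡ weight U c K
weight-rotate U zero    per c       = refl
weight-rotate U (suc K) per zero    = refl
weight-rotate U (suc K) per (suc c) = trans (weight-rotate U (suc K) per c) shift
  where
  wrap : K + suc c ≡ c + suc K
  wrap = trans (+-comm K (suc c)) (sym (+-suc c K))
  shift : weight U c (suc K) ≡ weight U (suc c) (suc K)
  shift = begin
    ψ (U c) (U (suc c)) + weight U (suc c) K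
      ≡⟨ +-comm _ (weight U (suc c) K) ⟩
    weight U (suc c) K + ψ (U c) (U (suc c))
      ≡⟨ cong₂ (λ y z → weight U (suc c) K + ψ y z)
               (sym (trans (cong U wrap) (per c))) (sym (trans (cong U (cong suc wrap)) (per (suc c)))) ⟩
    weight U (suc c) K + ψ (U (K + suc c)) (U (suc (K + suc c)))
      ≡⟨ sym (weight-snoc U K (suc c)) ⟩
    weight U (suc c) (suc K) ∎
    where open ≡-Reasoning

weight-split : ∀ U c r → weight U c (4 + r) ≡ windowAt U c + weight U (4 + c) r
weight-split U c r =
  reassoc (ψ (U c) (U (suc c))) (ψ (U (suc c)) (U (2 + c))) (ψ (U (2 + c)) (U (3 + c)))
          (ψ (U (3 + c)) (U (4 + c))) (weight U (4 + c) r)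
  where
  reassoc : ∀ p q s t w → p + (q + (s + (t + w))) ≡ (p + (q + (s + t))) + w
  reassoc = solve-∀

weight-exchange : ∀ U V r c → (∀ j → j ≤ r → U (j + (4 + c)) ≡ V (j + (4 + c))) →
                  weight U c (4 + r) + windowAt V c ≡ weight V c (4 + r) + windowAt U c
weight-exchange U V r c agree = begin
  weight U c (4 + r) + windowAt V c               ≡⟨ cong (_+ windowAt V c) (weight-split U c r) ⟩
  (windowAt U c + weight U (4 + c) r) + windowAt V c ≡⟨ cong (λ z → (windowAt U c + z) + windowAt V c) outside ⟩
  (windowAt U c + weight V (4 + c) r) + windowAt V c ≡⟨ swap (windowAt U c) (weight V (4 + c) r) (windowAt V c) ⟩
  (windowAt V c + weight V (4 + c) r) + windowAt U c ≡⟨ cong (_+ windowAt U c) (sym (weight-split V c r)) ⟩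
  weight V c (4 + r) + windowAt U c               ∎
  where
  open ≡-Reasoning
  outside : weight U (4 + c) r ≡ weight V (4 + c) r
  outside = weight-cong U V r (4 + c) agree
  swap : ∀ p q s → (p + q) + s ≡ (s + q) + p
  swap = solve-∀

weight-exchange-periodic : ∀ U V r → (∀ m → U (m + (4 + r)) ≡ U m) → (∀ m → V (m + (4 + r)) ≡ V m) →
                           ∀ c → (∀ j → j ≤ r → U (j + (4 + c)) ≡ V (j + (4 + c))) →
                           weight U 0 (4 + r) + windowAt V c ≡ weight V 0 (4 + r) + windowAt U c
weight-exchange-periodic U V r perU perV c agree = begin
  weight U 0 (4 + r) + windowAt V c  ≡⟨ cong (_+ windowAt V c) (weight-rotate U (4 + r) perU c) ⟩
  weight U c (4 + r) + windowAt V c  ≡⟨ weight-exchange U V r c agree ⟩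
  weight V c (4 + r) + windowAt U c  ≡⟨ cong (_+ windowAt U c) (sym (weight-rotate V (4 + r) perV c)) ⟩
  weight V 0 (4 + r) + windowAt U c  ∎
  where open ≡-Reasoning

-- without two consecutive undominated vertices every pair weighs 0 or 2
weight-even : ∀ U → (∀ m → U m ≡ true → U (suc m) ≡ false) → ∀ n c → ∃[ q ] weight U c n ≡ q + q
weight-even U isolated zero    c = 0 , refl
weight-even U isolated (suc n) c with pair (U c) (U (suc c)) (isolated c) | weight-even U isolated n (suc c)
  where
  pair : ∀ x y → (x ≡ true → y ≡ false) → ∃[ q ] ψ x y ≡ q + q
  pair true  true  h with () ← h refl
  pair true  false h = 1 , refl
  pair false y     h = 0 , refl
... | q₁ , e₁ | q₂ , e₂ = q₁ + q₂ , trans (cong₂ _+_ e₁ e₂) (regroup q₁ q₂)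
  where
  regroup : ∀ p q → (p + p) + (q + q) ≡ (p + q) + (p + q)
  regroup = solve-∀

-- Finite facts about windows, each decided by evaluating a Boolean test
-- on all 32 patterns of five flags.

_⇒ᵇ_ : Bool → Bool → Bool
true  ⇒ᵇ y = y
false ⇒ᵇ _ = true

both : (Bool → Bool) → Bool
both f = f true ∧ f false

both-sound : ∀ f → both f ≡ true → ∀ x → f x ≡ true
both-sound f ok true  = proj₁ (∧-elim (f true) (f false) ok)
both-sound f ok false = proj₂ (∧-elim (f true) (f false) ok)

all⁵ : (Bool → Bool → Bool → Bool → Bool → Bool) → Bool
all⁵ f = both λ x₀ → both λ x₁ → both λ x₂ → both λ x₃ → both λ x₄ → f x₀ x₁ x₂ x₃ x₄

all⁵-sound : ∀ f → all⁵ f ≡ true → ∀ x₀ x₁ x₂ x₃ x₄ → f x₀ x₁ x₂ x₃ x₄ ≡ true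
all⁵-sound f ok x₀ x₁ x₂ x₃ x₄ =
  both-sound (f x₀ x₁ x₂ x₃) (both-sound (λ y → both (f x₀ x₁ x₂ y))
    (both-sound (λ y → both λ z → both (f x₀ x₁ y z))
      (both-sound (λ y → both λ z → both λ w → both (f x₀ y z w))
        (both-sound (λ y → both λ z → both λ w → both λ v → both (f y z w v)) ok x₀) x₁) x₂) x₃) x₄

⇒ᵇ-elim : ∀ {h y} → (h ⇒ᵇ y) ≡ true → h ≡ true → y ≡ true
⇒ᵇ-elim e refl = e

⇒ᵇ-≤ : ∀ {h m n} → (h ⇒ᵇ (m ≤ᵇ n)) ≡ true → h ≡ true → m ≤ n
⇒ᵇ-≤ {m = m} {n} e h = ≤ᵇ⇒≤ m n (≡⇒T (⇒ᵇ-elim e h))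

-- A move dominating some vertex among the middle three flags of a window
-- (and nothing outside it) turns it into (x₀, false, false, false, x₄),
-- of weight ψ x₀ false.
window-drop-1 : ∀ x₀ x₁ x₂ x₃ x₄ → x₁ ∨ x₂ ∨ x₃ ≡ true → 1 + ψ x₀ false ≤ window x₀ x₁ x₂ x₃ x₄
window-drop-1 x₀ x₁ x₂ x₃ x₄ = ⇒ᵇ-≤ (all⁵-sound
  (λ x₀ x₁ x₂ x₃ x₄ → (x₁ ∨ x₂ ∨ x₃) ⇒ᵇ (1 + ψ x₀ false ≤ᵇ window x₀ x₁ x₂ x₃ x₄)) refl x₀ x₁ x₂ x₃ x₄)

window-drop-2 : ∀ x₀ x₁ x₂ x₃ x₄ → not x₁ ∧ x₂ ∧ not x₃ ≡ true → 2 + ψ x₀ false ≤ window x₀ x₁ x₂ x₃ x₄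
window-drop-2 x₀ x₁ x₂ x₃ x₄ = ⇒ᵇ-≤ (all⁵-sound
  (λ x₀ x₁ x₂ x₃ x₄ → (not x₁ ∧ x₂ ∧ not x₃) ⇒ᵇ (2 + ψ x₀ false ≤ᵇ window x₀ x₁ x₂ x₃ x₄)) refl x₀ x₁ x₂ x₃ x₄)

-- … and by at least 3 at a run end: the move at x₂ dominates the last
-- three vertices x₁x₂x₃ of a run of undominated vertices, or a whole run
-- x₁x₂ of exactly two.
runEnd : Bool → Bool → Bool → Bool → Bool → Bool
runEnd x₀ x₁ x₂ x₃ x₄ = (x₁ ∧ x₂ ∧ x₃ ∧ not x₄) ∨ (not x₀ ∧ x₁ ∧ x₂ ∧ not x₃)

runEnd-cong : ∀ {x₀ x₁ x₂ x₃ x₄ y₀ y₁ y₂ y₃ y₄} →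
              x₀ ≡ y₀ → x₁ ≡ y₁ → x₂ ≡ y₂ → x₃ ≡ y₃ → x₄ ≡ y₄ →
              runEnd x₀ x₁ x₂ x₃ x₄ ≡ runEnd y₀ y₁ y₂ y₃ y₄
runEnd-cong refl refl refl refl refl = refl

window-drop-3 : ∀ x₀ x₁ x₂ x₃ x₄ → runEnd x₀ x₁ x₂ x₃ x₄ ≡ true → 3 + ψ x₀ false ≤ window x₀ x₁ x₂ x₃ x₄
window-drop-3 x₀ x₁ x₂ x₃ x₄ = ⇒ᵇ-≤ (all⁵-sound
  (λ x₀ x₁ x₂ x₃ x₄ → runEnd x₀ x₁ x₂ x₃ x₄ ⇒ᵇ (3 + ψ x₀ false ≤ᵇ window x₀ x₁ x₂ x₃ x₄)) refl x₀ x₁ x₂ x₃ x₄)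

runEnd⇒middle : ∀ x₀ x₁ x₂ x₃ x₄ → runEnd x₀ x₁ x₂ x₃ x₄ ≡ true → x₂ ≡ true
runEnd⇒middle x₀ x₁ x₂ x₃ x₄ = ⇒ᵇ-elim (all⁵-sound
  (λ x₀ x₁ x₂ x₃ x₄ → runEnd x₀ x₁ x₂ x₃ x₄ ⇒ᵇ x₂) refl x₀ x₁ x₂ x₃ x₄)

window-clear-middle : ∀ x₀ x₁ x₂ x₃ x₄ → window x₀ x₁ false x₃ x₄ ≤ window x₀ x₁ x₂ x₃ x₄
window-clear-middle x₀ x₁ x₂ x₃ x₄ = ⇒ᵇ-≤ {true} (all⁵-sound
  (λ x₀ x₁ x₂ x₃ x₄ → true ⇒ᵇ (window x₀ x₁ false x₃ x₄ ≤ᵇ window x₀ x₁ x₂ x₃ x₄)) refl x₀ x₁ x₂ x₃ x₄) refl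

-- Positions on the cycle C_K (K ≥ 2): natural numbers read modulo K.

module CyclePositions (k : ℕ) where

  K : ℕ
  K = suc (suc k)

  pos : ℕ → Fin K
  pos m = fromℕ< (m%n<n m K)

  toℕ-pos : ∀ m → toℕ (pos m) ≡ m % K
  toℕ-pos m = toℕ-fromℕ< (m%n<n m K)

  pos-≡ : ∀ m m' → m % K ≡ m' % K → pos m ≡ pos m'
  pos-≡ m m' e = toℕ-injective (trans (toℕ-pos m) (trans e (sym (toℕ-pos m'))))

  pos-toℕ : ∀ v → pos (toℕ v) ≡ v
  pos-toℕ v = toℕ-injective (trans (toℕ-pos (toℕ v)) (m<n⇒m%n≡m (toℕ<n v)))

  pos-periodic : ∀ m → pos (m + K) ≡ pos m
  pos-periodic m = pos-≡ (m + K) m ([m+n]%n≡m%n m K)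

  pos-mod : ∀ i m → pos (i + m) ≡ pos (i + m % K)
  pos-mod i m = pos-≡ (i + m) (i + m % K) (begin
    (i + m) % K               ≡⟨ %-distribˡ-+ i m K ⟩
    (i % K + m % K) % K       ≡⟨ cong (λ z → (i % K + z) % K) (sym (m%n%n≡m%n m K)) ⟩
    (i % K + m % K % K) % K   ≡⟨ sym (%-distribˡ-+ i (m % K) K) ⟩
    (i + m % K) % K           ∎)
    where open ≡-Reasoning

  pos-distinct : ∀ d x → 0 < d → d < K → pos (d + x) ≢ pos x
  pos-distinct d x 0<d d<K e with (d + x % K) / K | d≡q*K
    where
    d+r%K≡r : (d + x % K) % K ≡ x % K
    d+r%K≡r = begin
      (d + x % K) % K       ≡⟨ cong (λ z → (z + x % K) % K) (sym (m<n⇒m%n≡m d<K)) ⟩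
      (d % K + x % K) % K   ≡⟨ sym (%-distribˡ-+ d x K) ⟩
      (d + x) % K           ≡⟨ sym (toℕ-pos (d + x)) ⟩
      toℕ (pos (d + x))     ≡⟨ cong toℕ e ⟩
      toℕ (pos x)           ≡⟨ toℕ-pos x ⟩
      x % K                 ∎
      where open ≡-Reasoning
    d≡q*K : d ≡ ((d + x % K) / K) * K
    d≡q*K = +-cancelˡ-≡ (x % K) d _
      (trans (+-comm (x % K) d) (trans (m≡m%n+[m/n]*n (d + x % K) K) (cong (_+ ((d + x % K) / K) * K) d+r%K≡r)))
  ... | zero   | d≡0   = <-irrefl (sym d≡0) 0<d
  ... | suc q  | d≡qK  = <-irrefl refl (≤-trans d<K (≤-trans (m≤m+n K (q * K)) (≤-reflexive (sym d≡qK))))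

  cycSucc-decode : ∀ i j → cycSucc K i j ≡ true → suc (toℕ i) ≡ toℕ j ⊎ (suc (toℕ i) ≡ K × toℕ j ≡ 0)
  cycSucc-decode i j e with ∨-elim (suc (toℕ i) == toℕ j) _ e
  ... | inj₁ next = inj₁ (==⇒≡ _ _ next)
  ... | inj₂ wrap with ∧-elim (suc (toℕ i) == K) (toℕ j == 0) wrap
  ... | last , first = inj₂ (==⇒≡ _ _ last , ==⇒≡ _ _ first)

  cycSucc-pos : ∀ m → cycSucc K (pos m) (pos (suc m)) ≡ true
  cycSucc-pos m with m≤n⇒m<n∨m≡n (m%n<n m K)
  ... | inj₁ inside =
    ∨-introˡ _ (subst (λ z → (suc (toℕ (pos m)) == z) ≡ true) (sym next) (==-refl (suc (toℕ (pos m)))))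
    where
    next : toℕ (pos (suc m)) ≡ suc (toℕ (pos m))
    next = begin
      toℕ (pos (suc m))   ≡⟨ toℕ-pos (suc m) ⟩
      (1 + m) % K         ≡⟨ %-distribˡ-+ 1 m K ⟩
      (1 + m % K) % K     ≡⟨ m<n⇒m%n≡m inside ⟩
      suc (m % K)         ≡⟨ cong suc (sym (toℕ-pos m)) ⟩
      suc (toℕ (pos m))   ∎
      where open ≡-Reasoning
  ... | inj₂ wraps = ∨-introʳ (suc (toℕ (pos m)) == toℕ (pos (suc m)))
      (subst₂ (λ y z → ((y == K) ∧ (z == 0)) ≡ true) (sym last) (sym first) (cong (_∧ true) (==-refl K)))
    where
    last : suc (toℕ (pos m)) ≡ K
    last = trans (cong suc (toℕ-pos m)) wraps
    first : toℕ (pos (suc m)) ≡ 0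
    first = begin
      toℕ (pos (suc m))   ≡⟨ toℕ-pos (suc m) ⟩
      (1 + m) % K         ≡⟨ %-distribˡ-+ 1 m K ⟩
      (1 + m % K) % K     ≡⟨ cong (_% K) wraps ⟩
      K % K               ≡⟨ n%n≡0 K ⟩
      0                   ∎
      where open ≡-Reasoning

  cycSucc-functional : ∀ i j j' → cycSucc K i j ≡ true → cycSucc K i j' ≡ true → j ≡ j'
  cycSucc-functional i j j' e e' with cycSucc-decode i j e | cycSucc-decode i j' e'
  ... | inj₁ p       | inj₁ q       = toℕ-injective (trans (sym p) q)
  ... | inj₁ p       | inj₂ (q , _) = ⊥-elim (<-irrefl (trans (sym p) q) (toℕ<n j))
  ... | inj₂ (p , _) | inj₁ q       = ⊥-elim (<-irrefl (trans (sym q) p) (toℕ<n j'))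
  ... | inj₂ (_ , p) | inj₂ (_ , q) = toℕ-injective (trans p (sym q))

  cycSucc-injective : ∀ i i' j → cycSucc K i j ≡ true → cycSucc K i' j ≡ true → i ≡ i'
  cycSucc-injective i i' j e e' with cycSucc-decode i j e | cycSucc-decode i' j e'
  ... | inj₁ p       | inj₁ q       = toℕ-injective (suc-injective (trans p (sym q)))
  ... | inj₁ p       | inj₂ (_ , q) with () ← trans p q
  ... | inj₂ (_ , p) | inj₁ q       with () ← trans q p
  ... | inj₂ (p , _) | inj₂ (q , _) = toℕ-injective (suc-injective (trans p (sym q)))

-- Index arithmetic for windows on C_K with K = 4 + r: the window centred
-- at position 2 + c covers c, …, c + 4, and c + 4, …, c + K lies outside.

-- r + (2 + x) and r + (3 + x) stand for x − 2 and x − 1 modulo 4 + r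
back-2 : ∀ r j x → (2 + j) + (r + (2 + x)) ≡ (j + x) + (4 + r)
back-2 = solve-∀

back-1 : ∀ r j x → (1 + j) + (r + (3 + x)) ≡ (j + x) + (4 + r)
back-1 = solve-∀

-- the last flag of the pairs outside the window is the first flag again
outside-end : ∀ r c → r + (4 + c) ≡ c + (4 + r)
outside-end = solve-∀

from-centre : ∀ j c → j + (4 + c) ≡ (2 + j) + (2 + c)
from-centre = solve-∀

from-right : ∀ j c → j + (4 + c) ≡ (1 + j) + (3 + c)
from-right = solve-∀

from-left : ∀ j c → j + (4 + c) ≡ (3 + j) + (1 + c)
from-left = solve-∀

-- The cycle C_K, K = 4 + r, with the chord ab.

module ChordCycle (r : ℕ) (a b : Fin (4 + r)) (a≢b : a ≢ b) where

  open CyclePositions (2 + r)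
  open Game (cycleWithChord K a b)

  G : Graph
  G = cycleWithChord K a b

  undom : VSet K → ℕ → Bool
  undom D m = not (D (pos m))

  undom-periodic : ∀ D m → undom D (m + K) ≡ undom D m
  undom-periodic D m = cong (not ∘ D) (pos-periodic m)

  undom-wrap : ∀ D {m} x → m ≡ x + K → undom D m ≡ undom D x
  undom-wrap D x refl = undom-periodic D x

  Φ : VSet K → ℕ
  Φ D = weight (undom D) 0 K

  Φ-exchange : ∀ D D' c → (∀ j → j ≤ r → undom D (j + (4 + c)) ≡ undom D' (j + (4 + c))) →
               Φ D + windowAt (undom D') c ≡ Φ D' + windowAt (undom D) c
  Φ-exchange D D' = weight-exchange-periodic (undom D) (undom D') r (undom-periodic D) (undom-periodic D')

  -- the positions reached in the game after Dominator's opening move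
  ChordDominated : VSet K → Set
  ChordDominated D = D a ≡ true × D b ≡ true

  cycNbr : Fin K → Fin K → Bool
  cycNbr v u = (toℕ u == toℕ v) ∨ cycAdj K v u

  cycNbr-decode : ∀ v u → cycNbr v u ≡ true → u ≡ v ⊎ cycSucc K v u ≡ true ⊎ cycSucc K u v ≡ true
  cycNbr-decode v u e with ∨-elim (toℕ u == toℕ v) _ e
  ... | inj₁ same = inj₁ (toℕ-injective (==⇒≡ _ _ same))
  ... | inj₂ adj  = inj₂ (∨-elim (cycSucc K v u) (cycSucc K u v) adj)

  nbr-decode : ∀ v u → closedNbr G v u ≡ true → cycNbr v u ≡ true ⊎ u ≡ b ⊎ u ≡ a
  nbr-decode v u e with ∨-elim (toℕ u == toℕ v) _ e
  ... | inj₁ same = inj₁ (∨-introˡ _ same)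
  ... | inj₂ e₁ with ∨-elim (cycAdj K v u) _ e₁
  ... | inj₁ adj = inj₁ (∨-introʳ (toℕ u == toℕ v) adj)
  ... | inj₂ e₂ with ∨-elim ((toℕ v == toℕ a) ∧ (toℕ u == toℕ b)) _ e₂
  ... | inj₁ ab = inj₂ (inj₁ (toℕ-injective (==⇒≡ _ _ (proj₂ (∧-elim (toℕ v == toℕ a) _ ab)))))
  ... | inj₂ ba = inj₂ (inj₂ (toℕ-injective (==⇒≡ _ _ (proj₂ (∧-elim (toℕ v == toℕ b) _ ba)))))

  cycNbr⊆closedNbr : ∀ v u → cycNbr v u ≡ true → closedNbr G v u ≡ true
  cycNbr⊆closedNbr v u e with ∨-elim (toℕ u == toℕ v) _ e
  ... | inj₁ same = ∨-introˡ _ same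
  ... | inj₂ adj  = ∨-introʳ (toℕ u == toℕ v) (∨-introˡ _ adj)

  chord-irrelevant : ∀ D → ChordDominated D → ∀ v u → closedNbr G v u ≡ true → D u ≡ false →
                     cycNbr v u ≡ true
  chord-irrelevant D (da , db) v u e du with nbr-decode v u e
  ... | inj₁ inCycle = inCycle
  ... | inj₂ (inj₁ refl) with () ← trans (sym db) du
  ... | inj₂ (inj₂ refl) with () ← trans (sym da) du

  outside-window : ∀ c j → j ≤ r → cycNbr (pos (2 + c)) (pos (j + (4 + c))) ≡ false
  outside-window c j j≤r with cycNbr (pos (2 + c)) (pos (j + (4 + c))) in e
  ... | false = refl
  ... | true with cycNbr-decode (pos (2 + c)) _ e
  ... | inj₁ same = ⊥-elim (pos-distinct (2 + j) (2 + c) (s≤s z≤n) (s≤s (s≤s (s≤s (m≤n⇒m≤1+n j≤r))))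
          (trans (cong pos (sym (from-centre j c))) same))
  ... | inj₂ (inj₁ succ) = ⊥-elim (pos-distinct (1 + j) (3 + c) (s≤s z≤n) (s≤s (s≤s (m≤n⇒m≤1+n (m≤n⇒m≤1+n j≤r))))
          (trans (cong pos (sym (from-right j c))) (cycSucc-functional (pos (2 + c)) _ _ succ (cycSucc-pos (2 + c)))))
  ... | inj₂ (inj₂ pred) = ⊥-elim (pos-distinct (3 + j) (1 + c) (s≤s z≤n) (s≤s (s≤s (s≤s (s≤s j≤r))))
          (trans (cong pos (sym (from-left j c))) (cycSucc-injective _ _ (pos (2 + c)) pred (cycSucc-pos (1 + c)))))

  centre : Fin K → ℕ
  centre v = r + (2 + toℕ v)

  pos-centre : ∀ v → pos (2 + centre v) ≡ v
  pos-centre v = trans (cong pos (back-2 r 0 (toℕ v))) (trans (pos-periodic (toℕ v)) (pos-toℕ v))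

  cycNbr-self : ∀ v → cycNbr v v ≡ true
  cycNbr-self v = ∨-introˡ _ (==-refl (toℕ v))

  nbr-self : ∀ c → cycNbr (pos (2 + c)) (pos (2 + c)) ≡ true
  nbr-self c = cycNbr-self (pos (2 + c))

  nbr-left : ∀ c → cycNbr (pos (2 + c)) (pos (1 + c)) ≡ true
  nbr-left c = ∨-introʳ (toℕ (pos (1 + c)) == toℕ (pos (2 + c)))
                 (∨-introʳ (cycSucc K (pos (2 + c)) (pos (1 + c))) (cycSucc-pos (1 + c)))

  nbr-right : ∀ c → cycNbr (pos (2 + c)) (pos (3 + c)) ≡ true
  nbr-right c = ∨-introʳ (toℕ (pos (3 + c)) == toℕ (pos (2 + c))) (∨-introˡ _ (cycSucc-pos (2 + c)))

  -- The effect of a move v = pos (2 + c) on the potential, when a and b are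
  -- already dominated: it dominates the undominated vertices among
  -- c + 1, c + 2, c + 3 and nothing else, so only the window at c changes
  -- and it becomes (x₀, false, false, false, x₄) of weight ψ x₀ false.
  module Move (D : VSet K) (chordDom : ChordDominated D) (c : ℕ) (v : Fin K) (centred : pos (2 + c) ≡ v) where

    D' : VSet K
    D' = play G D v

    outside-unchanged : ∀ j → j ≤ r → undom D (j + (4 + c)) ≡ undom D' (j + (4 + c))
    outside-unchanged j j≤r with D (pos (j + (4 + c))) in dominated | closedNbr G v (pos (j + (4 + c))) in reached
    ... | true  | _     = refl
    ... | false | false = refl
    ... | false | true  with () ← trans (sym (chord-irrelevant D chordDom v _ reached dominated))
                                        (subst (λ w → cycNbr w (pos (j + (4 + c))) ≡ false) centred (outside-window c j j≤r))

    dominated-by-v : ∀ m → cycNbr v (pos m) ≡ true → undom D' m ≡ false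
    dominated-by-v m e = cong not (∨-introʳ (D (pos m)) (cycNbr⊆closedNbr v (pos m) e))

    window-after : windowAt (undom D') c ≡ window (undom D c) false false false (undom D (4 + c))
    window-after = window-cong first-unchanged
      (dominated-by-v (1 + c) (subst (λ w → cycNbr w (pos (1 + c)) ≡ true) centred (nbr-left c)))
      (dominated-by-v (2 + c) (subst (λ w → cycNbr w (pos (2 + c)) ≡ true) centred (nbr-self c)))
      (dominated-by-v (3 + c) (subst (λ w → cycNbr w (pos (3 + c)) ≡ true) centred (nbr-right c)))
      (sym (outside-unchanged 0 z≤n))
      where
      first-unchanged : undom D' c ≡ undom D c
      first-unchanged = begin
        undom D' c                ≡⟨ sym (undom-wrap D' c (outside-end r c)) ⟩
        undom D' (r + (4 + c))    ≡⟨ sym (outside-unchanged r ≤-refl) ⟩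
        undom D (r + (4 + c))     ≡⟨ undom-wrap D c (outside-end r c) ⟩
        undom D c                 ∎
        where open ≡-Reasoning

    Φ-balance : Φ D + ψ (undom D c) false ≡ Φ D' + windowAt (undom D) c
    Φ-balance = begin
      Φ D + ψ (undom D c) false                       ≡⟨ cong (Φ D +_) (sym (trans window-after (+-identityʳ _))) ⟩
      Φ D + windowAt (undom D') c                     ≡⟨ Φ-exchange D D' c outside-unchanged ⟩
      Φ D' + windowAt (undom D) c                     ∎
      where open ≡-Reasoning

    Φ-drop : ∀ e → e + ψ (undom D c) false ≤ windowAt (undom D) c → e + Φ D' ≤ Φ D
    Φ-drop e drop = +-cancelˡ-≤ ψ₀ (e + Φ D') (Φ D) (begin
      ψ₀ + (e + Φ D')                 ≡⟨ sym (+-assoc ψ₀ e (Φ D')) ⟩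
      (ψ₀ + e) + Φ D'                 ≡⟨ cong (_+ Φ D') (+-comm ψ₀ e) ⟩
      (e + ψ₀) + Φ D'                 ≤⟨ +-monoˡ-≤ (Φ D') drop ⟩
      windowAt (undom D) c + Φ D'     ≡⟨ +-comm _ (Φ D') ⟩
      Φ D' + windowAt (undom D) c     ≡⟨ sym Φ-balance ⟩
      Φ D + ψ₀                        ≡⟨ +-comm (Φ D) ψ₀ ⟩
      ψ₀ + Φ D                        ∎)
      where
      open ≤-Reasoning
      ψ₀ = ψ (undom D c) false

  undom-at : ∀ D u m → pos m ≡ u → D u ≡ false → undom D m ≡ true
  undom-at D u m e du = trans (cong (not ∘ D) e) (cong not du)

  legal⇒middle-undominated : ∀ D → ChordDominated D → ∀ v → legal G D v ≡ true →
                             undom D (1 + centre v) ∨ undom D (2 + centre v) ∨ undom D (3 + centre v) ≡ true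
  legal⇒middle-undominated D cd v l with legal⇒witness D v l
  ... | u , reached , du with cycNbr-decode v u (chord-irrelevant D cd v u reached du)
  ... | inj₁ u≡v = ∨-introʳ (undom D (1 + c)) (∨-introˡ _ (undom-at D u (2 + c) (trans (pos-centre v) (sym u≡v)) du))
    where c = centre v
  ... | inj₂ (inj₁ v→u) = ∨-introʳ (undom D (1 + c)) (∨-introʳ (undom D (2 + c)) (undom-at D u (3 + c) right du))
    where
    c = centre v
    right : pos (3 + c) ≡ u
    right = cycSucc-functional v (pos (3 + c)) u
              (subst (λ w → cycSucc K w (pos (3 + c)) ≡ true) (pos-centre v) (cycSucc-pos (2 + c))) v→u
  ... | inj₂ (inj₂ u→v) = ∨-introˡ _ (undom-at D u (1 + c) left du)
    where
    c = centre v
    left : pos (1 + c) ≡ u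
    left = cycSucc-injective (pos (1 + c)) u v
             (subst (λ w → cycSucc K (pos (1 + c)) w ≡ true) (pos-centre v) (cycSucc-pos (1 + c))) u→v

  staller-drop : ∀ D → ChordDominated D → ∀ v → legal G D v ≡ true → 1 + Φ (play G D v) ≤ Φ D
  staller-drop D cd v l = Move.Φ-drop D cd (centre v) v (pos-centre v) 1
    (window-drop-1 _ _ _ _ _ (legal⇒middle-undominated D cd v l))

  runEndAt : VSet K → ℕ → Bool
  runEndAt D c = runEnd (undom D c) (undom D (1 + c)) (undom D (2 + c)) (undom D (3 + c)) (undom D (4 + c))

  runEnd-centre : ∀ D c → runEndAt D c ≡ true → D (pos (2 + c)) ≡ false
  runEnd-centre D c end = not-injective (runEnd⇒middle (undom D c) (undom D (1 + c)) (undom D (2 + c))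
                                                       (undom D (3 + c)) (undom D (4 + c)) end)

  undom-mod : ∀ D i m → undom D (i + m) ≡ undom D (i + toℕ (pos m))
  undom-mod D i m = cong (not ∘ D) (trans (pos-mod i m) (cong (λ z → pos (i + z)) (sym (toℕ-pos m))))

  -- it suffices to look for run ends at c < K
  runEndAt-mod : ∀ D m → runEndAt D m ≡ runEndAt D (toℕ (pos m))
  runEndAt-mod D m = runEnd-cong (undom-mod D 0 m) (undom-mod D 1 m) (undom-mod D 2 m)
                                 (undom-mod D 3 m) (undom-mod D 4 m)

  -- If there is no run end, no two consecutive vertices are undominated: a
  -- pair of undominated vertices would extend to a run covering the whole
  -- cycle, but a is dominated.
  module NoRunEnd (D : VSet K) (cd : ChordDominated D) (none : ∀ m → runEndAt D m ≡ false) where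

    no-run-end : ∀ c → runEndAt D c ≡ true → ⊥
    no-run-end c e with () ← trans (sym e) (none c)

    -- an undominated pair x, x + 1 followed by a dominated x + 2 would give a
    -- run end at x − 2 (if x − 1 is undominated) or at x − 1 (otherwise)
    run-continues : ∀ x → undom D x ≡ true → undom D (1 + x) ≡ true → undom D (2 + x) ≡ true
    run-continues x u₀ u₁ with undom D (2 + x) in u₂
    ... | true  = refl
    ... | false with undom D (r + (3 + x)) in u₋₁
    ... | true  = ⊥-elim (no-run-end (r + (2 + x)) (runEnd-cong {y₀ = undom D (r + (2 + x))} refl
                    (trans (cong (undom D) (sym (+-suc r (2 + x)))) u₋₁)
                    (trans (undom-wrap D x (back-2 r 0 x)) u₀)
                    (trans (undom-wrap D (1 + x) (back-2 r 1 x)) u₁)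
                    (trans (undom-wrap D (2 + x) (back-2 r 2 x)) u₂)))
    ... | false = ⊥-elim (no-run-end (r + (3 + x)) (runEnd-cong {y₄ = undom D (4 + (r + (3 + x)))} u₋₁
                    (trans (undom-wrap D x (back-1 r 0 x)) u₀)
                    (trans (undom-wrap D (1 + x) (back-1 r 1 x)) u₁)
                    (trans (undom-wrap D (2 + x) (back-1 r 2 x)) u₂)
                    refl))

    run-forever : ∀ x → undom D x ≡ true → undom D (1 + x) ≡ true → ∀ t → undom D (t + x) ≡ true
    run-forever x u₀ u₁ t = proj₁ (pairs t)
      where
      pairs : ∀ t → undom D (t + x) ≡ true × undom D (1 + t + x) ≡ true
      pairs zero    = u₀ , u₁
      pairs (suc t) with pairs t
      ... | p , q = q , run-continues (t + x) p q

    -- walking  lap x  steps from x leads to a, which is dominated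
    lap : ℕ → ℕ
    lap x = (K ∸ toℕ (pos x)) + toℕ a

    lap-reaches-a : ∀ x → undom D (lap x + x) ≡ false
    lap-reaches-a x = begin
      undom D (lap x + x)             ≡⟨ undom-mod D (lap x) x ⟩
      undom D (lap x + toℕ (pos x))   ≡⟨ undom-wrap D (toℕ a) arrive ⟩
      undom D (toℕ a)                 ≡⟨ cong (not ∘ D) (pos-toℕ a) ⟩
      not (D a)                       ≡⟨ cong not (proj₁ cd) ⟩
      false                           ∎
      where
      open ≡-Reasoning
      arrive : lap x + toℕ (pos x) ≡ toℕ a + K
      arrive = begin
        (K ∸ toℕ (pos x)) + toℕ a + toℕ (pos x)   ≡⟨ cong (_+ toℕ (pos x)) (+-comm (K ∸ toℕ (pos x)) (toℕ a)) ⟩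
        toℕ a + (K ∸ toℕ (pos x)) + toℕ (pos x)   ≡⟨ +-assoc (toℕ a) _ _ ⟩
        toℕ a + ((K ∸ toℕ (pos x)) + toℕ (pos x)) ≡⟨ cong (toℕ a +_) (m∸n+n≡m (<⇒≤ (toℕ<n (pos x)))) ⟩
        toℕ a + K                                 ∎

    isolated : ∀ x → undom D x ≡ true → undom D (1 + x) ≡ false
    isolated x u₀ with undom D (1 + x) in u₁
    ... | false = refl
    ... | true  with () ← trans (sym (run-forever x u₀ u₁ (lap x))) (lap-reaches-a x)

    Φ-even : ∃[ q ] Φ D ≡ q + q
    Φ-even = weight-even (undom D) isolated K 0

    -- any undominated vertex is isolated, so playing it lowers Φ by 2
    isolated-drop : ∀ u → D u ≡ false → 2 + Φ (play G D u) ≤ Φ D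
    isolated-drop u du = Move.Φ-drop D cd c u (pos-centre u) 2
                           (window-drop-2 _ _ _ _ _ (isolated-pattern left middle right))
      where
      c = centre u
      middle : undom D (2 + c) ≡ true
      middle = undom-at D u (2 + c) (pos-centre u) du
      left : undom D (1 + c) ≡ false
      left with undom D (1 + c) in u₁
      ... | false = refl
      ... | true with () ← trans (sym middle) (isolated (1 + c) u₁)
      right : undom D (3 + c) ≡ false
      right = isolated (2 + c) middle
      isolated-pattern : ∀ {x₁ x₂ x₃} → x₁ ≡ false → x₂ ≡ true → x₃ ≡ false → not x₁ ∧ x₂ ∧ not x₃ ≡ true
      isolated-pattern refl refl refl = refl

  -- Dominator's reply lowers the bound ⌊Φ/2⌋ by one: at a run end if there
  -- is one (Φ drops by 3), otherwise at an undominated vertex (Φ is even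
  -- and drops by 2).
  dominator-move : ∀ D → ChordDominated D → ∀ v → legal G D v ≡ true →
                   ∃[ w ] legal G D w ≡ true × suc ⌈ Φ (play G D w) /2⌉ ≤ ⌊ Φ D /2⌋
  dominator-move D cd v l with any? (λ i → runEndAt D (toℕ i) ≟ᵇ true)
  ... | yes (i , end) =
    pos (2 + c) ,
    undominated⇒legal D (pos (2 + c)) (runEnd-centre D c end) ,
    halve-drop-3 (Move.Φ-drop D cd c (pos (2 + c)) refl 3 (window-drop-3 _ _ _ _ _ end))
    where c = toℕ i
  ... | no noEnd with legal⇒witness D v l
  ... | u , _ , du =
    u ,
    undominated⇒legal D u du ,
    subst (λ z → suc ⌈ Φ (play G D u) /2⌉ ≤ ⌊ z /2⌋) (sym even)
          (halve-drop-2-even q (subst (2 + Φ (play G D u) ≤_) even (isolated-drop u du)))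
    where
    none : ∀ m → runEndAt D m ≡ false
    none m = trans (runEndAt-mod D m) (¬-not (λ end → noEnd (pos m , end)))
    open NoRunEnd D cd none
    q = proj₁ Φ-even
    even = proj₂ Φ-even

  bound : Player → VSet K → ℕ
  bound dominator D = ⌊ Φ D /2⌋
  bound staller   D = ⌈ Φ D /2⌉

  chordDominated-play : ∀ D v → ChordDominated D → ChordDominated (play G D v)
  chordDominated-play D v (da , db) = ∨-introˡ _ da , ∨-introˡ _ db

  open PotentialBound ChordDominated chordDominated-play bound dominator-move
         (λ D cd v l → halve-drop-1 (staller-drop D cd v l))

  -- Compared with the same move in the bare cycle,
  -- which lowers Φ from K to K − 2, it additionally dominates b, which
  -- cannot raise Φ.
  D₀ : VSet K
  D₀ _ = false

  D₁ : VSet K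
  D₁ = play G D₀ a

  weight-undominated : ∀ c n → weight (λ _ → true) c n ≡ n
  weight-undominated c zero    = refl
  weight-undominated c (suc n) = cong suc (weight-undominated (suc c) n)

  -- in the bare cycle the opening turns the window at a from (1,1,1,1,1) into
  -- (1,0,0,0,1), lowering Φ from K to K − 2
  Φ-cycle-opening : Φ (cycNbr a) + 2 ≡ K
  Φ-cycle-opening = +-cancelʳ-≡ 2 _ _ (begin
    (Φ (cycNbr a) + 2) + 2                              ≡⟨ +-assoc (Φ (cycNbr a)) 2 2 ⟩
    Φ (cycNbr a) + windowAt (undom D₀) ca               ≡⟨ sym (Φ-exchange D₀ (cycNbr a) ca outside) ⟩
    Φ D₀ + windowAt (undom (cycNbr a)) ca               ≡⟨ cong₂ _+_ (weight-undominated 0 K) window-at-a ⟩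
    K + 2                                               ∎)
    where
    open ≡-Reasoning
    ca = centre a
    far : ∀ j → j ≤ r → cycNbr a (pos (j + (4 + ca))) ≡ false
    far j j≤r = subst (λ w → cycNbr w (pos (j + (4 + ca))) ≡ false) (pos-centre a) (outside-window ca j j≤r)
    near : ∀ {m} → cycNbr (pos (2 + ca)) (pos m) ≡ true → undom (cycNbr a) m ≡ false
    near {m} e = cong not (subst (λ w → cycNbr w (pos m) ≡ true) (pos-centre a) e)
    outside : ∀ j → j ≤ r → undom D₀ (j + (4 + ca)) ≡ undom (cycNbr a) (j + (4 + ca))
    outside j j≤r = sym (cong not (far j j≤r))
    window-at-a : windowAt (undom (cycNbr a)) ca ≡ 2
    window-at-a = window-cong {y₀ = true} {y₁ = false} {y₂ = false} {y₃ = false} {y₄ = true}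
      (trans (sym (undom-wrap (cycNbr a) ca (outside-end r ca))) (cong not (far r ≤-refl)))
      (near {1 + ca} (nbr-left ca)) (near {2 + ca} (nbr-self ca)) (near {3 + ca} (nbr-right ca)) (cong not (far 0 z≤n))

  ==-false : ∀ {u w : Fin K} → u ≢ w → (toℕ u == toℕ w) ≡ false
  ==-false {u} {w} u≢w with toℕ u == toℕ w in e
  ... | false = refl
  ... | true  = ⊥-elim (u≢w (toℕ-injective (==⇒≡ _ _ e)))

  opening-off-b : ∀ u → u ≢ b → D₁ u ≡ cycNbr a u
  opening-off-b u u≢b = cong ((toℕ u == toℕ a) ∨_) (trans (cong (cycAdj K a u ∨_) chord) (∨-identityʳ _))
    where
    chord : ((toℕ a == toℕ a) ∧ (toℕ u == toℕ b)) ∨ ((toℕ a == toℕ b) ∧ (toℕ u == toℕ a)) ≡ false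
    chord rewrite ==-false u≢b | ==-false a≢b = trans (∨-identityʳ _) (∧-zeroʳ _)

  a-dominated : D₁ a ≡ true
  a-dominated = ∨-introˡ _ (==-refl (toℕ a))

  b-dominated : D₁ b ≡ true
  b-dominated = ∨-introʳ (toℕ b == toℕ a) (∨-introʳ (cycAdj K a b)
                  (∨-introˡ _ (∧-intro (==-refl (toℕ a)) (==-refl (toℕ b)))))

  -- D₁ differs from the bare cycle opening only at b, the centre of the
  -- window at centre b, where it has one more dominated vertex
  Φ-opening : Φ D₁ ≤ Φ (cycNbr a)
  Φ-opening = +-cancelʳ-≤ (windowAt (undom (cycNbr a)) cb) _ _ (begin
    Φ D₁ + windowAt (undom (cycNbr a)) cb     ≡⟨ Φ-exchange D₁ (cycNbr a) cb outside ⟩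
    Φ (cycNbr a) + windowAt (undom D₁) cb     ≤⟨ +-monoʳ-≤ (Φ (cycNbr a)) b-cleared ⟩
    Φ (cycNbr a) + windowAt U cb              ∎)
    where
    open ≤-Reasoning
    cb = centre b
    U = undom (cycNbr a)
    off-b : ∀ m → pos m ≢ b → undom D₁ m ≡ U m
    off-b m ne = cong not (opening-off-b (pos m) ne)
    apart : ∀ d x → 0 < d → d < K → pos (d + x) ≡ b → pos x ≢ b
    apart d x 0<d d<K e e' = pos-distinct d x 0<d d<K (trans e (sym e'))
    apart' : ∀ d x → 0 < d → d < K → pos x ≡ b → pos (d + x) ≢ b
    apart' d x 0<d d<K e e' = pos-distinct d x 0<d d<K (trans e' (sym e))
    far-from-b : ∀ j → j ≤ r → pos (j + (4 + cb)) ≢ b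
    far-from-b j j≤r e with () ← trans (sym (cycNbr-self (pos (2 + cb))))
      (subst (λ w → cycNbr (pos (2 + cb)) w ≡ false) (trans e (sym (pos-centre b))) (outside-window cb j j≤r))
    outside : ∀ j → j ≤ r → undom D₁ (j + (4 + cb)) ≡ U (j + (4 + cb))
    outside j j≤r = off-b (j + (4 + cb)) (far-from-b j j≤r)
    window-at-b : windowAt (undom D₁) cb ≡ window (U cb) (U (1 + cb)) false (U (3 + cb)) (U (4 + cb))
    window-at-b = window-cong
      (off-b cb (apart 2 cb (s≤s z≤n) (s≤s (s≤s (s≤s z≤n))) (pos-centre b)))
      (off-b (1 + cb) (apart 1 (1 + cb) (s≤s z≤n) (s≤s (s≤s z≤n)) (pos-centre b)))
      (trans (cong (not ∘ D₁) (pos-centre b)) (cong not b-dominated))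
      (off-b (3 + cb) (apart' 1 (2 + cb) (s≤s z≤n) (s≤s (s≤s z≤n)) (pos-centre b)))
      (off-b (4 + cb) (apart' 2 (2 + cb) (s≤s z≤n) (s≤s (s≤s (s≤s z≤n))) (pos-centre b)))
    b-cleared : windowAt (undom D₁) cb ≤ windowAt U cb
    b-cleared = ≤-trans (≤-reflexive window-at-b)
                        (window-clear-middle (U cb) (U (1 + cb)) (U (2 + cb)) (U (3 + cb)) (U (4 + cb)))

  γg-bound : γg G ≤ ⌈ K /2⌉
  γg-bound = begin
    γg G                                   ≤⟨ dominator-plays (3 + r) D₀ a (undominated⇒legal D₀ a refl) ⟩
    suc (gameValue G (3 + r) staller D₁)   ≤⟨ s≤s (gameValue≤B (3 + r) staller D₁ (a-dominated , b-dominated)) ⟩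
    suc ⌈ Φ D₁ /2⌉                         ≤⟨ halve-drop-opening opening-drop ⟩
    ⌈ K /2⌉                                ∎
    where
    open ≤-Reasoning
    opening-drop : 2 + Φ D₁ ≤ K
    opening-drop = ≤-trans (+-monoʳ-≤ 2 Φ-opening) (≤-reflexive (trans (+-comm 2 _) Φ-cycle-opening))

-- Proposition 5.1: write k = 4 + r and apply γg-bound.  The argument does not
-- need the hypothesis that the chord is not already an edge of the cycle.
proposition5p1 : (k : ℕ) → 4 ≤ k → (a b : Fin k) → a ≢ b → cycAdj k a b ≡ false →
    γg (cycleWithChord k a b) ≤ ⌈ n (cycleWithChord k a b) /2⌉
proposition5p1 (suc (suc (suc (suc r)))) (s≤s (s≤s (s≤s (s≤s z≤n)))) a b a≢b _ = ChordCycle.γg-bound r a b a≢b
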